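{- Let $N$ be a net. The relation $\sqsubseteq_0^\infty$ is a preorder on $\mathrm{FS}^\infty(N)$. Consequently $\equiv_0^\infty$ is an equivalence relation on $\mathrm{FS}^\infty(N)$.
   Context: A net is $N=(S,T,F,M_0)$ with $S,T$ disjoint, $F:(S\times T)\cup(T\times S)\to\mathbb{N}$, $M_0:S\to\mathbb{N}$, each transition having finitely many and at least one preplace ($F(s,t)>0$) and finitely many postplaces. ${}^\bullet x(y)=F(y,x)$, $x^\bullet(y)=F(x,y)$, extended additively to finite multisets. For markings $M,M'$ and finite non-empty multiset $G$ of transitions, $M\xrightarrow{G}M'$ iff ${}^\bullet G\le M$ and $M'=(M-{}^\bullet G)+G^\bullet$. For a finite or infinite word $\sigma=t_1t_2\cdots$ over $T$, $M\xrightarrow{\sigma}$ means $M\xrightarrow{\{t_1\}}M_1\xrightarrow{\{t_2\}}\cdots$. $\mathrm{FS}^\infty(N)$: words $\sigma$ with $M_0\xrightarrow{\sigma}$; $\mathrm{FS}(N)$: the finite ones. $\le$ is the prefix order. $\sigma\equiv_0\rho$ iff both are firing sequences, $\sigma=\sigma_1tu\sigma_2$, $\rho=\sigma_1ut\sigma_2$ and $M_0\xrightarrow{\sigma_1}M\xrightarrow{\{t,u\}}$ for some $M$; $\equiv_0^*$ is its reflexive transitive closure. $\sigma\sqsubseteq_0^\infty\rho$ iff for every $\sigma''\in\mathrm{FS}(N)$ with $\sigma''\le\sigma$ there are $\sigma',\rho'\in\mathrm{FS}(N)$ with $\sigma''\le\sigma'\equiv_0^*\rho'\le\rho$. $\sigma\equiv_0^\infty\rho$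 iff $\sigma\sqsubseteq_0^\infty\rho$ and $\rho\sqsubseteq_0^\infty\sigma$. -}

module Defs where

open import Data.Nat using (ℕ; zero; suc; _+_; _∸_; _≤_; _<_)
open import Data.List using (List; []; _∷_; _++_; [_])
open import Data.List.Membership.Propositional using (_∈_)
open import Data.Product using (Σ; ∃; ∃-syntax; _×_; _,_)
open import Relation.Binary.PropositionalEquality using (_≡_)
open import Relation.Binary.Construct.Closure.ReflexiveTransitive using (Star)

-- A place/transition net N = (S, T, F, M₀).  S and T are separate types
-- (hence disjoint); F is split into its S×T part (pre) and T×S part (post).
record Net : Set₁ where
  field
    S     : Set
    T     : Set
    pre   : S → T → ℕ
    post  : T → S → ℕ
    M₀    : S → ℕ
    pre-finite  : (t : T) → Σ (List S) λ ss → (s : S) → 0 < pre s t → s ∈ ss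
    pre-nonempty : (t : T) → ∃[ s ] 0 < pre s t
    post-finite : (t : T) → Σ (List S) λ ss → (s : S) → 0 < post t s → s ∈ ss

module _ (N : Net) where
  open Net N

  Marking : Set
  Marking = S → ℕ

  -- finite multisets of transitions, represented by lists
  -- (•G)(s) = Σ_{t ∈ G} F(s,t), (G•)(s) = Σ_{t ∈ G} F(t,s)
  preM : List T → S → ℕ
  preM []      s = 0
  preM (t ∷ G) s = pre s t + preM G s

  postM : List T → S → ℕ
  postM []      s = 0
  postM (t ∷ G) s = post t s + postM G s

  Step : Marking → List T → Marking → Set
  Step M []      M' = Data.Empty.⊥ where import Data.Empty
  Step M (t ∷ G) M' =
    ((s : S) → preM (t ∷ G) s ≤ M s) ×
    ((s : S) → M' s ≡ (M s ∸ preM (t ∷ G) s) + postM (t ∷ G) s)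

  data Fires : Marking → List T → Marking → Set where
    fires-[] : ∀ {M M'} → ((s : S) → M s ≡ M' s) → Fires M [] M'
    fires-∷  : ∀ {M M₁ M'} {t σ} → Step M [ t ] M₁ → Fires M₁ σ M' →
               Fires M (t ∷ σ) M'

  data Word : Set where
    fin : List T → Word
    inf : (ℕ → T) → Word

  FiringSeq : Word → Set
  FiringSeq (fin σ) = ∃[ M ] Fires M₀ σ M
  FiringSeq (inf f) =
    Σ (ℕ → Marking) λ Ms →
      ((s : S) → Ms 0 s ≡ M₀ s) × ((i : ℕ) → Step (Ms i) [ f i ] (Ms (suc i)))

  FS : List T → Set
  FS σ = FiringSeq (fin σ)

  _≤ₗ_ : List T → List T → Set
  σ ≤ₗ ρ = ∃[ w ] ρ ≡ σ ++ w

  initial : ℕ → (ℕ → T) → List T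
  initial zero    f = []
  initial (suc n) f = f 0 ∷ initial n (λ i → f (suc i))

  _≤w_ : List T → Word → Set
  σ ≤w fin ρ = σ ≤ₗ ρ
  σ ≤w inf f = ∃[ n ] σ ≡ initial n f

  _≡₀_ : List T → List T → Set
  σ ≡₀ ρ = FS σ × FS ρ ×
    (∃[ σ₁ ] ∃[ σ₂ ] ∃[ t ] ∃[ u ]
      (σ ≡ σ₁ ++ (t ∷ u ∷ σ₂)) × (ρ ≡ σ₁ ++ (u ∷ t ∷ σ₂)) ×
      (∃[ M ] ∃[ M' ] Fires M₀ σ₁ M × Step M (t ∷ u ∷ []) M'))

  _≡₀*_ : List T → List T → Set
  _≡₀*_ = Star _≡₀_

  _⊑₀∞_ : Word → Word → Set
  σ ⊑₀∞ ρ = (σ'' : List T) → FS σ'' → σ'' ≤w σ →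
    ∃[ σ' ] ∃[ ρ' ] FS σ' × FS ρ' × σ'' ≤ₗ σ' × σ' ≡₀* ρ' × ρ' ≤w ρ

  _≡₀∞_ : Word → Word → Set
  σ ≡₀∞ ρ = (σ ⊑₀∞ ρ) × (ρ ⊑₀∞ σ)

{-# OPTIONS --safe #-}
module Submission where

-- Firing t and then u from M reaches (M + t• + u•) ∸ (•t + •u) whenever both
-- steps are enabled, a value symmetric in t and u. Hence swapping two
-- concurrently enabled transitions does not change the reached marking, so
-- ≡₀*-equivalent sequences reach the same marking and admit the same
-- extensions w, with σ ++ w ≡₀* ρ ++ w. Reflexivity of ⊑₀^∞ is immediate;
-- for transitivity, a witness σ'' ≤ σ' ≡₀* ρ' ≤ ρ is composed with a witness
-- ρ' ≤ ρ' ++ w ≡₀* τ' ≤ τ by extending the first chain by w.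

open import Defs
open import Data.Product using (_×_; _,_; ∃-syntax; proj₁)
open import Data.Nat using (_+_; _∸_; _≤_)
open import Data.Nat.Properties
  using (≤-trans; m≤m+n; +-monoʳ-≤; m+[n∸m]≡n; +-∸-comm; ∸-+-assoc; +-assoc; +-comm)
open import Data.List using ([]; _∷_; _++_; [_])
open import Data.List.Properties using (++-assoc; ++-identityʳ)
open import Relation.Binary.PropositionalEquality
  using (_≡_; refl; sym; trans; cong; cong₂; subst; module ≡-Reasoning)
open import Relation.Binary.Construct.Closure.ReflexiveTransitive using (ε; _◅_; _◅◅_)

∸+-∸+ : ∀ {m a b c d} → a ≤ m → c ≤ m ∸ a + b →
        m ∸ a + b ∸ c + d ≡ m + b + d ∸ (a + c)
∸+-∸+ {m} {a} {b} {c} {d} a≤m c≤ = begin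
  m ∸ a + b ∸ c + d    ≡⟨ cong (λ x → x ∸ c + d) m∸a+b≡m+b∸a ⟩
  m + b ∸ a ∸ c + d    ≡⟨ cong (_+ d) (∸-+-assoc (m + b) a c) ⟩
  m + b ∸ (a + c) + d  ≡⟨ +-∸-comm d a+c≤m+b ⟨
  m + b + d ∸ (a + c)  ∎
  where
  open ≡-Reasoning
  m∸a+b≡m+b∸a : m ∸ a + b ≡ m + b ∸ a
  m∸a+b≡m+b∸a = sym (+-∸-comm b a≤m)
  a≤m+b : a ≤ m + b
  a≤m+b = ≤-trans a≤m (m≤m+n m b)
  a+c≤m+b : a + c ≤ m + b
  a+c≤m+b = subst (a + c ≤_) (m+[n∸m]≡n a≤m+b)
                  (+-monoʳ-≤ a (subst (c ≤_) m∸a+b≡m+b∸a c≤))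

+-+-∸-+-comm : ∀ m b d a c → m + b + d ∸ (a + c) ≡ m + d + b ∸ (c + a)
+-+-∸-+-comm m b d a c = cong₂ _∸_
  (trans (+-assoc m b d) (trans (cong (m +_) (+-comm b d)) (sym (+-assoc m d b))))
  (+-comm a c)

module _ (N : Net) where
  open Net N

  _≈ₘ_ : Marking N → Marking N → Set
  M ≈ₘ M' = (s : S) → M s ≡ M' s

  Fires-respˡ : ∀ {M M' X σ} → M ≈ₘ M' → Fires N M' σ X → Fires N M σ X
  Fires-respˡ M≈M' (fires-[] M'≈X) = fires-[] (λ s → trans (M≈M' s) (M'≈X s))
  Fires-respˡ M≈M' (fires-∷ {t = t} (enabled , update) σ-fires) =
    fires-∷ ((λ s → subst (preM N [ t ] s ≤_) (sym (M≈M' s)) (enabled s)) ,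
             (λ s → trans (update s)
                      (cong (λ x → x ∸ preM N [ t ] s + postM N [ t ] s) (sym (M≈M' s)))))
            σ-fires

  Fires-++⁻ : ∀ {M X} σ ρ → Fires N M (σ ++ ρ) X → ∃[ K ] Fires N M σ K × Fires N K ρ X
  Fires-++⁻ []      ρ ρ-fires = _ , fires-[] (λ _ → refl) , ρ-fires
  Fires-++⁻ (t ∷ σ) ρ (fires-∷ step rest) with Fires-++⁻ σ ρ rest
  ... | K , σ-fires , ρ-fires = K , fires-∷ step σ-fires , ρ-fires

  Fires-++⁺ : ∀ {M K X} σ {ρ} → Fires N M σ K → Fires N K ρ X → Fires N M (σ ++ ρ) X
  Fires-++⁺ []      (fires-[] M≈K)     ρ-fires = Fires-respˡ M≈K ρ-fires
  Fires-++⁺ (t ∷ σ) (fires-∷ step rest) ρ-fires = fires-∷ step (Fires-++⁺ σ rest ρ-fires)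

  Fires-deterministic : ∀ {M M' X Y σ} → M ≈ₘ M' → Fires N M σ X → Fires N M' σ Y → X ≈ₘ Y
  Fires-deterministic M≈M' (fires-[] M≈X) (fires-[] M'≈Y) s =
    trans (sym (M≈X s)) (trans (M≈M' s) (M'≈Y s))
  Fires-deterministic M≈M' (fires-∷ {t = t} (_ , update) rest) (fires-∷ (_ , update') rest') =
    Fires-deterministic
      (λ s → trans (update s)
               (trans (cong (λ x → x ∸ preM N [ t ] s + postM N [ t ] s) (M≈M' s))
                      (sym (update' s))))
      rest rest'

  fireTwice : Marking N → T → T → Marking N
  fireTwice M t u s = M s + postM N [ t ] s + postM N [ u ] s ∸ (preM N [ t ] s + preM N [ u ] s)

  Step-Step : ∀ {M M₁ M₂ t u} → Step N M [ t ] M₁ → Step N M₁ [ u ] M₂ → M₂ ≈ₘ fireTwice M t u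
  Step-Step {t = t} {u} (t-enabled , t-update) (u-enabled , u-update) s =
    trans (u-update s)
      (trans (cong (λ x → x ∸ preM N [ u ] s + postM N [ u ] s) (t-update s))
             (∸+-∸+ (t-enabled s) (subst (preM N [ u ] s ≤_) (t-update s) (u-enabled s))))

  fireTwice-comm : ∀ {M M'} t u → M ≈ₘ M' → fireTwice M t u ≈ₘ fireTwice M' u t
  fireTwice-comm {M} {M'} t u M≈M' s =
    trans (cong (λ m → m + postM N [ t ] s + postM N [ u ] s ∸ (preM N [ t ] s + preM N [ u ] s))
                (M≈M' s))
          (+-+-∸-+-comm (M' s) (postM N [ t ] s) (postM N [ u ] s) (preM N [ t ] s) (preM N [ u ] s))

  ≡₀-sameMarking : ∀ {σ ρ X Y} → _≡₀_ N σ ρ → Fires N M₀ σ X → Fires N M₀ ρ Y → X ≈ₘ Y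
  ≡₀-sameMarking (_ , _ , σ₁ , σ₂ , t , u , refl , refl , _) σ-fires ρ-fires
    with Fires-++⁻ σ₁ (t ∷ u ∷ σ₂) σ-fires | Fires-++⁻ σ₁ (u ∷ t ∷ σ₂) ρ-fires
  ... | _ , σ₁-fires  , fires-∷ t-step  (fires-∷ u-step  σ₂-fires)
      | _ , σ₁-fires' , fires-∷ u-step' (fires-∷ t-step' σ₂-fires') =
    Fires-deterministic after-swap σ₂-fires σ₂-fires'
    where
    after-swap : _ ≈ₘ _
    after-swap s = trans (Step-Step t-step u-step s)
      (trans (fireTwice-comm t u (Fires-deterministic (λ _ → refl) σ₁-fires σ₁-fires') s)
             (sym (Step-Step u-step' t-step' s)))

  ≡₀-FS-++ : ∀ {σ ρ} w → _≡₀_ N σ ρ → FS N (ρ ++ w) → FS N (σ ++ w)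
  ≡₀-FS-++ {σ} {ρ} w σ≡₀ρ@((_ , σ-fires) , _) (X , ρw-fires) with Fires-++⁻ ρ w ρw-fires
  ... | _ , ρ-fires , w-fires =
    X , Fires-++⁺ σ σ-fires (Fires-respˡ (≡₀-sameMarking σ≡₀ρ σ-fires ρ-fires) w-fires)

  ≡₀-++ʳ : ∀ {σ ρ} w → _≡₀_ N σ ρ → FS N (ρ ++ w) → _≡₀_ N (σ ++ w) (ρ ++ w)
  ≡₀-++ʳ w σ≡₀ρ@(_ , _ , σ₁ , σ₂ , t , u , refl , refl , swap-enabled) ρw-fs =
    ≡₀-FS-++ w σ≡₀ρ ρw-fs , ρw-fs , σ₁ , σ₂ ++ w , t , u ,
    ++-assoc σ₁ (t ∷ u ∷ σ₂) w , ++-assoc σ₁ (u ∷ t ∷ σ₂) w , swap-enabled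

  ≡₀*-FSˡ : ∀ {σ ρ} → _≡₀*_ N σ ρ → FS N ρ → FS N σ
  ≡₀*-FSˡ ε          ρ-fs = ρ-fs
  ≡₀*-FSˡ (σ≡₀τ ◅ _) _    = proj₁ σ≡₀τ

  ≡₀*-++ʳ : ∀ {σ ρ} w → _≡₀*_ N σ ρ → FS N (ρ ++ w) → _≡₀*_ N (σ ++ w) (ρ ++ w)
  ≡₀*-++ʳ w ε              _     = ε
  ≡₀*-++ʳ w (σ≡₀τ ◅ τ≡₀*ρ) ρw-fs =
    ≡₀-++ʳ w σ≡₀τ (≡₀*-FSˡ τw≡₀*ρw ρw-fs) ◅ τw≡₀*ρw
    where
    τw≡₀*ρw : _≡₀*_ N (_ ++ w) (_ ++ w)
    τw≡₀*ρw = ≡₀*-++ʳ w τ≡₀*ρ ρw-fs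

  ⊑₀∞-refl : (σ : Word N) → _⊑₀∞_ N σ σ
  ⊑₀∞-refl σ σ'' σ''-fs σ''≤σ =
    σ'' , σ'' , σ''-fs , σ''-fs , ([] , sym (++-identityʳ σ'')) , ε , σ''≤σ

  ⊑₀∞-trans : (σ ρ τ : Word N) → _⊑₀∞_ N σ ρ → _⊑₀∞_ N ρ τ → _⊑₀∞_ N σ τ
  ⊑₀∞-trans σ ρ τ σ⊑ρ ρ⊑τ σ'' σ''-fs σ''≤σ
    with σ⊑ρ σ'' σ''-fs σ''≤σ
  ... | σ' , ρ' , _ , ρ'-fs , (v , refl) , σ'≡₀*ρ' , ρ'≤ρ
    with ρ⊑τ ρ' ρ'-fs ρ'≤ρ
  ... | _ , τ' , ρ'w-fs , τ'-fs , (w , refl) , ρ'w≡₀*τ' , τ'≤τ =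
    σ' ++ w , τ' , ≡₀*-FSˡ σ'w≡₀*ρ'w ρ'w-fs , τ'-fs , (v ++ w , ++-assoc σ'' v w) ,
    σ'w≡₀*ρ'w ◅◅ ρ'w≡₀*τ' , τ'≤τ
    where
    σ'w≡₀*ρ'w : _≡₀*_ N (σ' ++ w) (ρ' ++ w)
    σ'w≡₀*ρ'w = ≡₀*-++ʳ w σ'≡₀*ρ' ρ'w-fs

proposition1 : (N : Net) →
    -- ⊑₀^∞ is a preorder on FS^∞(N)
    (((σ : Word N) → FiringSeq N σ → _⊑₀∞_ N σ σ) ×
     ((σ ρ τ : Word N) → FiringSeq N σ → FiringSeq N ρ → FiringSeq N τ →
        _⊑₀∞_ N σ ρ → _⊑₀∞_ N ρ τ → _⊑₀∞_ N σ τ)) ×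
    -- ≡₀^∞ is an equivalence relation on FS^∞(N)
    (((σ : Word N) → FiringSeq N σ → _≡₀∞_ N σ σ) ×
     ((σ ρ : Word N) → FiringSeq N σ → FiringSeq N ρ →
        _≡₀∞_ N σ ρ → _≡₀∞_ N ρ σ) ×
     ((σ ρ τ : Word N) → FiringSeq N σ → FiringSeq N ρ → FiringSeq N τ →
        _≡₀∞_ N σ ρ → _≡₀∞_ N ρ τ → _≡₀∞_ N σ τ))
proposition1 N =
  ((λ σ _ → ⊑₀∞-refl N σ) , (λ σ ρ τ _ _ _ → ⊑₀∞-trans N σ ρ τ)) ,
  (λ σ _ → ⊑₀∞-refl N σ , ⊑₀∞-refl N σ) ,
  (λ _ _ _ _ (σ⊑ρ , ρ⊑σ) → ρ⊑σ , σ⊑ρ) ,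
  (λ σ ρ τ _ _ _ (σ⊑ρ , ρ⊑σ) (ρ⊑τ , τ⊑ρ) →
     ⊑₀∞-trans N σ ρ τ σ⊑ρ ρ⊑τ , ⊑₀∞-trans N τ ρ σ τ⊑ρ ρ⊑σ)
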